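{- The language $Q_{\overline{I}}$ is reflective: for all $x, y \in V^*$, if $xy \in Q_{\overline{I}}$ then $yx \in Q_{\overline{I}}$.
   Context: $V$ is a finite alphabet with at least two distinct letters; $V^*$ is the set of all finite words over $V$ (including the empty word). A nonempty word $w$ is primitive if it is not of the form $v^n$ for a word $v$ and an integer $n \ge 2$; $Q$ is the set of primitive words. For a word $w$ of length $n$, $w[1..i]$ denotes its prefix of length $i$ and $w[i+1..n]$ its suffix of length $n-i$. A primitive word $w$ of length $n$ is ins-robust if for every $i \in \{0,\ldots,n\}$ and every $a \in V$ the word $w[1..i]\,a\,w[i+1..n]$ is primitive; $Q_I$ is the set of ins-robust primitive words and $Q_{\overline{I}} = Q \setminus Q_I$. A language $L \subseteq V^*$ is reflective if $uv \in L$ implies $vu \in L$ for all $u, v \in V^*$. -}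

module Defs where

open import Data.Nat using (ℕ; _≤_; _≥_)
open import Data.List using (List; []; _∷_; _++_; length; take; drop; concat; replicate)
open import Data.Product using (Σ; _×_; ∃-syntax)
open import Relation.Binary.PropositionalEquality using (_≡_; _≢_)
open import Relation.Nullary using (¬_)

Word : Set → Set
Word V = List V

_^ʷ_ : {V : Set} → Word V → ℕ → Word V
v ^ʷ n = concat (replicate n v)

Primitive : {V : Set} → Word V → Set
Primitive {V} w = (w ≢ []) × ¬ (∃[ v ] ∃[ n ] ((n ≥ 2) × (w ≡ v ^ʷ n)))

insertAt : {V : Set} → ℕ → V → Word V → Word V
insertAt i a w = take i w ++ (a ∷ drop i w)

InsRobust : {V : Set} → Word V → Set
InsRobust {V} w = Primitive w × ((i : ℕ) → i ≤ length w → (a : V) → Primitive (insertAt i a w))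

QIbar : {V : Set} → Word V → Set
QIbar w = Primitive w × ¬ InsRobust w

-- Rotation preserves primitivity (a proper power v^n rotated by one letter is the power of the
-- rotated v), and a one-letter insertion into x ++ y is, up to rotation, a one-letter insertion
-- into y ++ x. Hence rotation preserves ins-robustness too, and so also its failure.
module Submission where

open import Defs
open import Data.Nat using (ℕ; _≥_)
open import Data.Fin using (Fin)
open import Data.List using (_++_)

open import Data.Nat using (zero; suc; _+_; _≤_; z≤n; s≤s)
open import Data.Nat.Properties using (≤-trans; m≤m+n; +-monoʳ-≤)
open import Data.List using (List; []; _∷_; [_]; length)
open import Data.List.Properties using (++-assoc; ++-identityʳ; ++-conicalˡ; ++-conicalʳ; length-++)
open import Data.Product using (_×_; _,_; ∃-syntax)
open import Data.Sum using (_⊎_; inj₁; inj₂; [_,_]′)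
open import Relation.Binary.PropositionalEquality
  using (_≡_; _≢_; refl; sym; trans; cong; cong₂; subst; module ≡-Reasoning)

module _ {V : Set} where

  open ≡-Reasoning

  ProperPower : Word V → Set
  ProperPower w = ∃[ v ] ∃[ n ] ((n ≥ 2) × (w ≡ v ^ʷ n))

  []^ʷ : (n : ℕ) → ([] {A = V}) ^ʷ n ≡ []
  []^ʷ zero    = refl
  []^ʷ (suc n) = []^ʷ n

  ^ʷ-conjugate : (u v : Word V) (n : ℕ) → (u ++ v) ^ʷ n ++ u ≡ u ++ (v ++ u) ^ʷ n
  ^ʷ-conjugate u v zero    = sym (++-identityʳ u)
  ^ʷ-conjugate u v (suc n) = begin
    ((u ++ v) ++ (u ++ v) ^ʷ n) ++ u  ≡⟨ ++-assoc (u ++ v) _ u ⟩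
    (u ++ v) ++ ((u ++ v) ^ʷ n ++ u)  ≡⟨ cong ((u ++ v) ++_) (^ʷ-conjugate u v n) ⟩
    (u ++ v) ++ (u ++ (v ++ u) ^ʷ n)  ≡⟨ ++-assoc u v _ ⟩
    u ++ (v ++ (u ++ (v ++ u) ^ʷ n))  ≡⟨ cong (u ++_) (++-assoc v u _) ⟨
    u ++ ((v ++ u) ++ (v ++ u) ^ʷ n)  ∎

  ProperPower-rotate-∷ : (a : V) (w : Word V) → ProperPower (a ∷ w) → ProperPower (w ++ [ a ])
  ProperPower-rotate-∷ a w ([] , n , _ , eq) with () ← trans eq ([]^ʷ n)
  ProperPower-rotate-∷ a w ((.a ∷ v) , suc (suc m) , s≤s (s≤s z≤n) , refl) =
    v ++ [ a ] , suc (suc m) , s≤s (s≤s z≤n) , (begin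
      (v ++ (a ∷ v) ^ʷ suc m) ++ [ a ]  ≡⟨ ++-assoc v _ [ a ] ⟩
      v ++ ((a ∷ v) ^ʷ suc m ++ [ a ])  ≡⟨ cong (v ++_) (^ʷ-conjugate [ a ] v (suc m)) ⟩
      v ++ (a ∷ (v ++ [ a ]) ^ʷ suc m)  ≡⟨ ++-assoc v [ a ] _ ⟨
      (v ++ [ a ]) ^ʷ suc (suc m)       ∎)

  ProperPower-rotate : (x y : Word V) → ProperPower (x ++ y) → ProperPower (y ++ x)
  ProperPower-rotate []      y p = subst ProperPower (sym (++-identityʳ y)) p
  ProperPower-rotate (a ∷ x) y p =
    subst ProperPower (++-assoc y [ a ] x)
      (ProperPower-rotate x (y ++ [ a ])
        (subst ProperPower (++-assoc x y [ a ]) (ProperPower-rotate-∷ a (x ++ y) p)))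

  ++-≢[]-comm : (x y : Word V) → x ++ y ≢ [] → y ++ x ≢ []
  ++-≢[]-comm x y x++y≢[] y++x≡[] =
    x++y≢[] (cong₂ _++_ (++-conicalʳ y x y++x≡[]) (++-conicalˡ y x y++x≡[]))

  Primitive-rotate : (x y : Word V) → Primitive (x ++ y) → Primitive (y ++ x)
  Primitive-rotate x y (x++y≢[] , ¬power) =
    ++-≢[]-comm x y x++y≢[] , λ power → ¬power (ProperPower-rotate y x power)

  insertAt-++ˡ : ∀ i (a : V) x y → i ≤ length x → insertAt i a (x ++ y) ≡ insertAt i a x ++ y
  insertAt-++ˡ zero    a x       y _         = refl
  insertAt-++ˡ (suc i) a (b ∷ x) y (s≤s i≤x) = cong (b ∷_) (insertAt-++ˡ i a x y i≤x)

  insertAt-++ʳ : ∀ j (a : V) x y → insertAt (length x + j) a (x ++ y) ≡ x ++ insertAt j a y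
  insertAt-++ʳ j a []      y = refl
  insertAt-++ʳ j a (b ∷ x) y = cong (b ∷_) (insertAt-++ʳ j a x y)

  insertAt-++-cases : ∀ i (a : V) x y → i ≤ length (x ++ y) →
    (∃[ j ] j ≤ length x × insertAt i a (x ++ y) ≡ insertAt j a x ++ y) ⊎
    (∃[ j ] j ≤ length y × insertAt i a (x ++ y) ≡ x ++ insertAt j a y)
  insertAt-++-cases i       a []      y i≤y       = inj₂ (i , i≤y , refl)
  insertAt-++-cases zero    a (b ∷ x) y _         = inj₁ (zero , z≤n , refl)
  insertAt-++-cases (suc i) a (b ∷ x) y (s≤s i≤) with insertAt-++-cases i a x y i≤
  ... | inj₁ (j , j≤x , eq) = inj₁ (suc j , s≤s j≤x , cong (b ∷_) eq)
  ... | inj₂ (j , j≤y , eq) = inj₂ (j , j≤y , cong (b ∷_) eq)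

  InsRobust-rotate : (x y : Word V) → InsRobust (x ++ y) → InsRobust (y ++ x)
  InsRobust-rotate x y (prim , robust) = Primitive-rotate x y prim , robust′
    where
    robust′ : ∀ i → i ≤ length (y ++ x) → (a : V) → Primitive (insertAt i a (y ++ x))
    robust′ i i≤ a = [ inserted-in-y , inserted-in-x ]′ (insertAt-++-cases i a y x i≤)
      where
      inserted-in-y : ∃[ j ] j ≤ length y × insertAt i a (y ++ x) ≡ insertAt j a y ++ x →
                      Primitive (insertAt i a (y ++ x))
      inserted-in-y (j , j≤y , eq) =
        subst Primitive (sym eq)
          (Primitive-rotate x (insertAt j a y)
            (subst Primitive (insertAt-++ʳ j a x y)
              (robust (length x + j) x+j≤ a)))
        where
        x+j≤ : length x + j ≤ length (x ++ y)
        x+j≤ = subst (length x + j ≤_) (sym (length-++ x)) (+-monoʳ-≤ (length x) j≤y)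

      inserted-in-x : ∃[ j ] j ≤ length x × insertAt i a (y ++ x) ≡ y ++ insertAt j a x →
                      Primitive (insertAt i a (y ++ x))
      inserted-in-x (j , j≤x , eq) =
        subst Primitive (sym eq)
          (Primitive-rotate (insertAt j a x) y
            (subst Primitive (insertAt-++ˡ j a x y j≤x)
              (robust j j≤ a)))
        where
        j≤ : j ≤ length (x ++ y)
        j≤ = subst (j ≤_) (sym (length-++ x)) (≤-trans j≤x (m≤m+n (length x) (length y)))

corollary12 : (k : ℕ) → k ≥ 2 → (x y : Word (Fin k)) →
    QIbar (x ++ y) → QIbar (y ++ x)
corollary12 k _ x y (prim , ¬robust) =
  Primitive-rotate x y prim , λ robust → ¬robust (InsRobust-rotate y x robust)
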